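{- If $A$ is a nonsingular $n\times n$ matrix with entries in $\mathbb{S}=\{0,1,1^\nu\}$, then $A$ has a row which has exactly one entry equal to $1$ and all its other entries equal to $0$.
   Context: The superboolean semiring $\mathbb{S}=\{0,1,1^\nu\}$ has addition $0+x=x$, $1+1=1^\nu$, $1+1^\nu=1^\nu+1^\nu=1^\nu$, and multiplication $0\cdot x=0$, $1\cdot x=x$, $1^\nu\cdot1^\nu=1^\nu$. $A$ is nonsingular if its permanent $\sum_{\pi\in S_n}a_{\pi(1),1}\cdots a_{\pi(n),n}$, computed in $\mathbb{S}$, equals $1$. (In the paper's terminology such a row is an $n$-marker.) -}

module Defs where

open import Data.Nat using (ℕ; zero; suc)
open import Data.Fin using (Fin; zero; suc; _≟_)
open import Data.List using (List; []; _∷_; map; concatMap; foldr; filter; allFin)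
open import Data.Product using (_×_; _,_)
open import Relation.Nullary using (Dec; yes; no; ¬_)
open import Relation.Binary.PropositionalEquality using (_≡_)
open import Data.Bool using (Bool; true; false; if_then_else_)

data 𝕊 : Set where
  𝟘 𝟙 𝟙ν : 𝕊

infixl 6 _⊕_
infixl 7 _⊗_

_⊕_ : 𝕊 → 𝕊 → 𝕊
𝟘 ⊕ y = y
𝟙 ⊕ 𝟘 = 𝟙
𝟙 ⊕ 𝟙 = 𝟙ν
𝟙 ⊕ 𝟙ν = 𝟙ν
𝟙ν ⊕ _ = 𝟙ν

_⊗_ : 𝕊 → 𝕊 → 𝕊
𝟘 ⊗ _ = 𝟘
𝟙 ⊗ y = y
𝟙ν ⊗ 𝟘 = 𝟘
𝟙ν ⊗ 𝟙 = 𝟙ν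
𝟙ν ⊗ 𝟙ν = 𝟙ν

-- n × n matrices over S, indexed as A i j (row i, column j)
Matrix : ℕ → Set
Matrix n = Fin n → Fin n → 𝕊

allFuns : (m n : ℕ) → List (Fin m → Fin n)
allFuns zero n = (λ ()) ∷ []
allFuns (suc m) n =
  concatMap (λ i → map (λ f → λ { zero → i ; (suc k) → f k }) (allFuns m n)) (allFin n)

allL : {A : Set} → (A → Bool) → List A → Bool
allL p [] = true
allL p (x ∷ xs) = if p x then allL p xs else false

isInjective : {m n : ℕ} → (Fin m → Fin n) → Bool
isInjective {m} f =
  allL (λ i → allL (λ j → eqF (f i) (f j) ⇒ eqF i j) (allFin m)) (allFin m)
  where
  eqF : {k : ℕ} → Fin k → Fin k → Bool
  eqF a b with a ≟ b
  ... | yes _ = true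
  ... | no _ = false
  _⇒_ : Bool → Bool → Bool
  true ⇒ b = b
  false ⇒ _ = true

-- the symmetric group S_n, listed as all bijections Fin n → Fin n
-- (an endomap of a finite set is a bijection iff it is injective)
permutations : (n : ℕ) → List (Fin n → Fin n)
permutations n = Data.List.filter (λ f → Data.Bool._≟_ (isInjective f) true) (allFuns n n)
  where import Data.Bool

prodS : (n : ℕ) → (Fin n → 𝕊) → 𝕊
prodS zero f = 𝟙
prodS (suc n) f = f zero ⊗ prodS n (λ k → f (suc k))

sumS : List 𝕊 → 𝕊
sumS = foldr _⊕_ 𝟘

per : {n : ℕ} → Matrix n → 𝕊
per {n} A = sumS (map (λ π → prodS n (λ j → A (π j) j)) (permutations n))

Nonsingular : {n : ℕ} → Matrix n → Set
Nonsingular A = per A ≡ 𝟙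

-- Let π be the unique permutation of nonzero weight, which exists because per A = 1 forces all
-- permutation weights but one to vanish and that one to be 1, so every a_{π(j),j} = 1.  If no row
-- π(j) were a marker, every column j would have a second nonzero entry a_{π(j),e(j)} with e(j) ≠ j.
-- The map e has a cycle c ↦ e c ↦ … ↦ e^{q+1} c = c; moving each row π(x) on the cycle one step
-- along it, to column e(x), gives a second permutation of nonzero weight, a contradiction.
module Submission where

open import Defs
open import Data.Nat using (ℕ; _≥_)
open import Data.Fin using (Fin)
open import Data.Product using (Σ; _×_)
open import Relation.Nullary using (¬_)
open import Relation.Binary.PropositionalEquality using (_≡_)

open import Data.Bool using (Bool; true)
open import Data.Bool.Properties using () renaming (_≟_ to _≟ᴮ_)
open import Data.Empty using (⊥-elim)
open import Data.Fin using (zero; suc; toℕ; _≟_)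
open import Data.Fin.Properties using (pigeonhole; all?; any?; ¬∀⟶∃¬)
open import Data.List using (List; []; _∷_; map; allFin)
open import Data.List.Membership.Propositional using (_∈_; lose; find)
open import Data.List.Membership.Propositional.Properties using (∈-filter⁺; ∈-filter⁻; ∈-allFin)
open import Data.List.Relation.Unary.Any using (Any; here; there)
open import Data.List.Relation.Unary.Any.Properties using (map⁺; concat⁺)
import Data.List.Relation.Unary.Any as Any
import Data.Nat as ℕ
open import Data.Nat.GeneralisedArithmetic using (fold; fold-+)
open import Data.Nat.Properties using (+-comm; m≤n⇒∃[o]m+o≡n; n<1+n)
open import Data.Product using (∃; ∃₂; _,_; proj₁; proj₂)
open import Data.Sum using (_⊎_; inj₁; inj₂)
open import Function.Base using (_∘_)
open import Function.Definitions using (Injective)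
open import Relation.Binary.Definitions using (DecidableEquality)
open import Relation.Binary.PropositionalEquality using (_≢_; _≗_; refl; sym; trans; cong; subst; module ≡-Reasoning)
open import Relation.Nullary using (Dec; yes; no)
open import Relation.Nullary.Decidable using (¬?; _×-dec_; decidable-stable)

_≟𝕊_ : DecidableEquality 𝕊
𝟘 ≟𝕊 𝟘 = yes refl
𝟘 ≟𝕊 𝟙 = no λ ()
𝟘 ≟𝕊 𝟙ν = no λ ()
𝟙 ≟𝕊 𝟘 = no λ ()
𝟙 ≟𝕊 𝟙 = yes refl
𝟙 ≟𝕊 𝟙ν = no λ ()
𝟙ν ≟𝕊 𝟘 = no λ ()
𝟙ν ≟𝕊 𝟙 = no λ ()
𝟙ν ≟𝕊 𝟙ν = yes refl

𝟙≢𝟘 : 𝟙 ≢ 𝟘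
𝟙≢𝟘 ()

⊕≡𝟙⁻ : ∀ a b → a ⊕ b ≡ 𝟙 → (a ≡ 𝟘 × b ≡ 𝟙) ⊎ (a ≡ 𝟙 × b ≡ 𝟘)
⊕≡𝟙⁻ 𝟘 b b≡𝟙 = inj₁ (refl , b≡𝟙)
⊕≡𝟙⁻ 𝟙 𝟘 _ = inj₂ (refl , refl)
⊕≡𝟙⁻ 𝟙 𝟙 ()
⊕≡𝟙⁻ 𝟙 𝟙ν ()
⊕≡𝟙⁻ 𝟙ν _ ()

⊗≡𝟙⁻ : ∀ a b → a ⊗ b ≡ 𝟙 → a ≡ 𝟙 × b ≡ 𝟙
⊗≡𝟙⁻ 𝟙 b b≡𝟙 = refl , b≡𝟙
⊗≡𝟙⁻ 𝟙ν 𝟘 ()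
⊗≡𝟙⁻ 𝟙ν 𝟙 ()
⊗≡𝟙⁻ 𝟙ν 𝟙ν ()

⊕-≢𝟘ˡ : ∀ {a} b → a ≢ 𝟘 → a ⊕ b ≢ 𝟘
⊕-≢𝟘ˡ {𝟘} b a≢𝟘 = ⊥-elim (a≢𝟘 refl)
⊕-≢𝟘ˡ {𝟙} 𝟘 _ ()
⊕-≢𝟘ˡ {𝟙} 𝟙 _ ()
⊕-≢𝟘ˡ {𝟙} 𝟙ν _ ()

⊕-≢𝟘ʳ : ∀ a {b} → b ≢ 𝟘 → a ⊕ b ≢ 𝟘
⊕-≢𝟘ʳ 𝟘 b≢𝟘 = b≢𝟘
⊕-≢𝟘ʳ 𝟙 {𝟘} b≢𝟘 = ⊥-elim (b≢𝟘 refl)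
⊕-≢𝟘ʳ 𝟙 {𝟙} _ ()
⊕-≢𝟘ʳ 𝟙 {𝟙ν} _ ()
⊕-≢𝟘ʳ 𝟙ν _ ()

⊗-≢𝟘 : ∀ {a b} → a ≢ 𝟘 → b ≢ 𝟘 → a ⊗ b ≢ 𝟘
⊗-≢𝟘 {𝟘} a≢𝟘 _ = ⊥-elim (a≢𝟘 refl)
⊗-≢𝟘 {𝟙} _ b≢𝟘 = b≢𝟘
⊗-≢𝟘 {𝟙ν} {𝟘} _ b≢𝟘 = ⊥-elim (b≢𝟘 refl)
⊗-≢𝟘 {𝟙ν} {𝟙} _ _ ()
⊗-≢𝟘 {𝟙ν} {𝟙ν} _ _ ()

module _ {X : Set} (f : X → 𝕊) where

  sumS-≢𝟘 : ∀ {x xs} → x ∈ xs → f x ≢ 𝟘 → sumS (map f xs) ≢ 𝟘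
  sumS-≢𝟘 {xs = y ∷ _} (here refl) fx≢𝟘 = ⊕-≢𝟘ˡ _ fx≢𝟘
  sumS-≢𝟘 {xs = y ∷ _} (there x∈ys) fx≢𝟘 = ⊕-≢𝟘ʳ (f y) (sumS-≢𝟘 x∈ys fx≢𝟘)

  sumS-≡𝟙⇒∃ : ∀ xs → sumS (map f xs) ≡ 𝟙 → ∃ λ x → x ∈ xs × f x ≡ 𝟙
  sumS-≡𝟙⇒∃ (y ∷ ys) sum≡𝟙 with ⊕≡𝟙⁻ (f y) _ sum≡𝟙
  ... | inj₂ (fy≡𝟙 , _) = y , here refl , fy≡𝟙
  ... | inj₁ (_ , rest≡𝟙) with sumS-≡𝟙⇒∃ ys rest≡𝟙
  ...   | x , x∈ys , fx≡𝟙 = x , there x∈ys , fx≡𝟙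

  sumS-≡𝟙⇒unique : ∀ {x y xs} → sumS (map f xs) ≡ 𝟙 → x ∈ xs → y ∈ xs →
                   f x ≢ 𝟘 → f y ≢ 𝟘 → x ≡ y
  sumS-≡𝟙⇒unique {x} {y} {z ∷ zs} sum≡𝟙 x∈ y∈ fx≢𝟘 fy≢𝟘 with ⊕≡𝟙⁻ (f z) _ sum≡𝟙
  ... | inj₁ (fz≡𝟘 , rest≡𝟙) =
    sumS-≡𝟙⇒unique rest≡𝟙 (in-tail fz≡𝟘 x∈ fx≢𝟘) (in-tail fz≡𝟘 y∈ fy≢𝟘) fx≢𝟘 fy≢𝟘
    where
    in-tail : ∀ {w} → f z ≡ 𝟘 → w ∈ z ∷ zs → f w ≢ 𝟘 → w ∈ zs
    in-tail fz≡𝟘 (here refl) fw≢𝟘 = ⊥-elim (fw≢𝟘 fz≡𝟘)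
    in-tail _ (there w∈zs) _ = w∈zs
  ... | inj₂ (_ , rest≡𝟘) = trans (is-head x∈ fx≢𝟘) (sym (is-head y∈ fy≢𝟘))
    where
    is-head : ∀ {w} → w ∈ z ∷ zs → f w ≢ 𝟘 → w ≡ z
    is-head (here w≡z) _ = w≡z
    is-head (there w∈zs) fw≢𝟘 = ⊥-elim (sumS-≢𝟘 w∈zs fw≢𝟘 rest≡𝟘)

prodS-≡𝟙 : ∀ n (h : Fin n → 𝕊) → prodS n h ≡ 𝟙 → ∀ j → h j ≡ 𝟙
prodS-≡𝟙 (ℕ.suc n) h prod≡𝟙 zero = proj₁ (⊗≡𝟙⁻ (h zero) _ prod≡𝟙)
prodS-≡𝟙 (ℕ.suc n) h prod≡𝟙 (suc j) =
  prodS-≡𝟙 n (λ k → h (suc k)) (proj₂ (⊗≡𝟙⁻ (h zero) _ prod≡𝟙)) j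

prodS-≢𝟘 : ∀ n (h : Fin n → 𝕊) → (∀ j → h j ≢ 𝟘) → prodS n h ≢ 𝟘
prodS-≢𝟘 ℕ.zero h _ ()
prodS-≢𝟘 (ℕ.suc n) h h≢𝟘 = ⊗-≢𝟘 (h≢𝟘 zero) (prodS-≢𝟘 n (λ k → h (suc k)) (λ k → h≢𝟘 (suc k)))

allL-sound : ∀ {A : Set} {p : A → Bool} xs → allL p xs ≡ true → ∀ {x} → x ∈ xs → p x ≡ true
allL-sound {p = p} (y ∷ ys) all≡true x∈ with p y in py≡true
allL-sound (y ∷ ys) _ (here refl) | true = py≡true
allL-sound (y ∷ ys) all≡true (there x∈ys) | true = allL-sound ys all≡true x∈ys

allL-complete : ∀ {A : Set} {p : A → Bool} xs → (∀ x → p x ≡ true) → allL p xs ≡ true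
allL-complete [] _ = refl
allL-complete {p = p} (y ∷ ys) p≡true rewrite p≡true y = allL-complete ys p≡true

predicateOf : ∀ {A : Set} {p : A → Bool} {xs : List A} {b : Bool} → allL p xs ≡ b → A → Bool
predicateOf {p = p} _ = p

-- The Boolean test that isInjective f performs on the pair (i , j).  Its ingredients are bound
-- in a where block of isInjective and cannot be named, so the test is read off by unification.
injectivityTest : ∀ {m n} (f : Fin m → Fin n) → Fin m → Fin m → Bool
injectivityTest {m} f i =
  predicateOf {xs = allFin m} {b = predicateOf {xs = allFin m} {b = isInjective f} refl i} refl

module _ {m n} (f : Fin m → Fin n) where

  injectivityTest-sound : ∀ i j → injectivityTest f i j ≡ true → f i ≡ f j → i ≡ j
  injectivityTest-sound i j test fi≡fj with f i ≟ f j
  ... | no fi≢fj = ⊥-elim (fi≢fj fi≡fj)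
  ... | yes _ with i ≟ j | test
  ...   | yes i≡j | _ = i≡j
  ...   | no _ | ()

  injectivityTest-complete : ∀ i j → (f i ≡ f j → i ≡ j) → injectivityTest f i j ≡ true
  injectivityTest-complete i j inj with f i ≟ f j
  ... | no _ = refl
  ... | yes fi≡fj with i ≟ j
  ...   | yes _ = refl
  ...   | no i≢j = ⊥-elim (i≢j (inj fi≡fj))

  isInjective⇒Injective : isInjective f ≡ true → Injective _≡_ _≡_ f
  isInjective⇒Injective isInj {i} {j} =
    injectivityTest-sound i j (allL-sound (allFin m) (allL-sound (allFin m) isInj (∈-allFin i)) (∈-allFin j))

  Injective⇒isInjective : Injective _≡_ _≡_ f → isInjective f ≡ true
  Injective⇒isInjective inj =
    allL-complete (allFin m) λ i → allL-complete (allFin m) λ j → injectivityTest-complete i j inj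

allFuns-complete : ∀ m n (f : Fin m → Fin n) → Any (_≗ f) (allFuns m n)
allFuns-complete ℕ.zero n f = here λ ()
allFuns-complete (ℕ.suc m) n f =
  concat⁺ (map⁺ (lose (∈-allFin (f zero))
    (map⁺ (Any.map (λ g≗ → λ { zero → refl ; (suc k) → g≗ k })
                   (allFuns-complete m n (λ k → f (suc k)))))))

isInjective? : ∀ {n} (f : Fin n → Fin n) → Dec (isInjective f ≡ true)
isInjective? f = isInjective f ≟ᴮ true

∈-permutations⇒Injective : ∀ {n} {π : Fin n → Fin n} → π ∈ permutations n → Injective _≡_ _≡_ π
∈-permutations⇒Injective {n} π∈ =
  isInjective⇒Injective _ (proj₂ (∈-filter⁻ isInjective? {xs = allFuns n n} π∈))

Injective⇒∃∈permutations : ∀ {n} (σ : Fin n → Fin n) → Injective _≡_ _≡_ σ →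
                           ∃ λ g → g ∈ permutations n × g ≗ σ
Injective⇒∃∈permutations {n} σ σ-inj with find (allFuns-complete n n σ)
... | g , g∈ , g≗σ = g , ∈-filter⁺ isInjective? g∈ (Injective⇒isInjective g g-inj) , g≗σ
  where
  g-inj : Injective _≡_ _≡_ g
  g-inj gi≡gj = σ-inj (trans (sym (g≗σ _)) (trans gi≡gj (g≗σ _)))

IsTransversal : ∀ {n} → (Fin n → Fin n → Set) → (Fin n → Fin n) → Set
IsTransversal R σ = Injective _≡_ _≡_ σ × (∀ j → R (σ j) j)

Support : ∀ {n} → Matrix n → Fin n → Fin n → Set
Support A i j = A i j ≢ 𝟘

weight : ∀ {n} → Matrix n → (Fin n → Fin n) → 𝕊
weight {n} A π = prodS n (λ j → A (π j) j)

nonsingular⇒unique-transversal : ∀ {n} (A : Matrix n) → Nonsingular A →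
  ∃ λ π → (∀ j → A (π j) j ≡ 𝟙) × IsTransversal (Support A) π ×
          (∀ σ → IsTransversal (Support A) σ → σ ≗ π)
nonsingular⇒unique-transversal {n} A per≡𝟙
  with π , π∈ , wπ≡𝟙 ← sumS-≡𝟙⇒∃ (weight A) (permutations n) per≡𝟙 =
  π , π-one , (∈-permutations⇒Injective π∈ , λ j a≡𝟘 → 𝟙≢𝟘 (trans (sym (π-one j)) a≡𝟘)) , unique
  where
  π-one : ∀ j → A (π j) j ≡ 𝟙
  π-one = prodS-≡𝟙 n _ wπ≡𝟙

  unique : ∀ σ → IsTransversal (Support A) σ → σ ≗ π
  unique σ (σ-inj , σ-supp) x with g , g∈ , g≗σ ← Injective⇒∃∈permutations σ σ-inj = begin
    σ x ≡⟨ sym (g≗σ x) ⟩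
    g x ≡⟨ cong (λ h → h x) g≡π ⟩
    π x ∎
    where
    open ≡-Reasoning
    wg≢𝟘 : weight A g ≢ 𝟘
    wg≢𝟘 = prodS-≢𝟘 n _ λ j → subst (λ i → A i j ≢ 𝟘) (sym (g≗σ j)) (σ-supp j)
    g≡π : g ≡ π
    g≡π = sumS-≡𝟙⇒unique (weight A) per≡𝟙 g∈ π∈ wg≢𝟘 (λ wπ≡𝟘 → 𝟙≢𝟘 (trans (sym wπ≡𝟙) wπ≡𝟘))

fold-comm : ∀ {A : Set} (e : A → A) x a b → fold (fold x e b) e a ≡ fold (fold x e a) e b
fold-comm e x a b = begin
  fold (fold x e b) e a ≡⟨ fold-+ x e a ⟨
  fold x e (a ℕ.+ b)    ≡⟨ cong (fold x e) (+-comm a b) ⟩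
  fold x e (b ℕ.+ a)    ≡⟨ fold-+ x e b ⟩
  fold (fold x e a) e b ∎
  where open ≡-Reasoning

endo-has-cycle : ∀ {n} (e : Fin (ℕ.suc n) → Fin (ℕ.suc n)) → ∃₂ λ c q → fold c e (ℕ.suc q) ≡ c
endo-has-cycle {n} e
  with i , j , i<j , eᶦ≡eʲ ← pigeonhole (n<1+n (ℕ.suc n)) (λ i → fold zero e (toℕ i))
  with q , i+1+q≡j ← m≤n⇒∃[o]m+o≡n i<j =
  fold zero e (toℕ i) , q , (begin
    fold (fold zero e (toℕ i)) e (ℕ.suc q) ≡⟨ fold-+ zero e (ℕ.suc q) ⟨
    fold zero e (ℕ.suc q ℕ.+ toℕ i)        ≡⟨ cong (λ k → fold zero e (ℕ.suc k)) (+-comm q (toℕ i)) ⟩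
    fold zero e (ℕ.suc (toℕ i) ℕ.+ q)      ≡⟨ cong (fold zero e) i+1+q≡j ⟩
    fold zero e (toℕ j)                    ≡⟨ eᶦ≡eʲ ⟨
    fold zero e (toℕ i)                    ∎)
  where open ≡-Reasoning

-- σ moves the rows π x of the cycle one step along it: row π (e^q x) goes to column e^{q+1} x = x.
transversal-along-cycle : ∀ {n} {R : Fin n → Fin n → Set} (π : Fin n → Fin n) → IsTransversal R π →
  (e : Fin n → Fin n) → (∀ j → e j ≢ j × R (π j) (e j)) →
  ∀ c q → fold c e (ℕ.suc q) ≡ c → ∃ λ σ → IsTransversal R σ × σ c ≢ π c
transversal-along-cycle {R = R} π (π-inj , π-supp) e e-escapes c q cycle =
  σ , (σ-inj , σ-supp) , σc≢πc
  where
  Periodic : Fin _ → Set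
  Periodic x = fold x e (ℕ.suc q) ≡ x

  periodic-closed : ∀ {x} → Periodic x → Periodic (fold x e q)
  periodic-closed {x} px = trans (fold-comm e x (ℕ.suc q) q) (cong (λ y → fold y e q) px)

  σ : Fin _ → Fin _
  σ x with fold x e (ℕ.suc q) ≟ x
  ... | yes _ = π (fold x e q)
  ... | no _ = π x

  σ-inj : Injective _≡_ _≡_ σ
  σ-inj {x} {y} σx≡σy with fold x e (ℕ.suc q) ≟ x | fold y e (ℕ.suc q) ≟ y
  ... | yes px | yes py = trans (sym px) (trans (cong e (π-inj σx≡σy)) py)
  ... | yes px | no ¬py = ⊥-elim (¬py (subst Periodic (π-inj σx≡σy) (periodic-closed px)))
  ... | no ¬px | yes py = ⊥-elim (¬px (subst Periodic (sym (π-inj σx≡σy)) (periodic-closed py)))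
  ... | no _ | no _ = π-inj σx≡σy

  σ-supp : ∀ x → R (σ x) x
  σ-supp x with fold x e (ℕ.suc q) ≟ x
  ... | yes px = subst (R (π (fold x e q))) px (proj₂ (e-escapes (fold x e q)))
  ... | no _ = π-supp x

  σc≢πc : σ c ≢ π c
  σc≢πc σc≡πc with fold c e (ℕ.suc q) ≟ c
  ... | yes _ = proj₁ (e-escapes c) (trans (cong e (sym (π-inj σc≡πc))) cycle)
  ... | no ¬pc = ¬pc cycle

unique-transversal⇒isolated-row : ∀ {n} {R : Fin (ℕ.suc n) → Fin (ℕ.suc n) → Set} →
  (∀ i j → Dec (R i j)) → (π : Fin (ℕ.suc n) → Fin (ℕ.suc n)) → IsTransversal R π →
  (∀ σ → IsTransversal R σ → σ ≗ π) → ∃ λ j → ∀ k → k ≢ j → ¬ R (π j) k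
unique-transversal⇒isolated-row {R = R} R? π π-trans unique = conclude (all? escape?)
  where
  Escapes : Fin _ → Set
  Escapes j = ∃ λ k → k ≢ j × R (π j) k

  escape? : ∀ j → Dec (Escapes j)
  escape? j = any? λ k → ¬? (k ≟ j) ×-dec R? (π j) k

  conclude : Dec (∀ j → Escapes j) → ∃ λ j → ∀ k → k ≢ j → ¬ R (π j) k
  conclude (yes escapes)
    with c , q , cycle ← endo-has-cycle (proj₁ ∘ escapes)
    with σ , σ-trans , σc≢πc ← transversal-along-cycle {R = R} π π-trans (proj₁ ∘ escapes) (proj₂ ∘ escapes)
                                 c q cycle
    = ⊥-elim (σc≢πc (unique σ σ-trans c))
  conclude (no ¬escapes) with j , ¬escape ← ¬∀⟶∃¬ _ _ escape? ¬escapes =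
    j , λ k k≢j r → ¬escape (k , k≢j , r)

corollary3p4 : (n : ℕ) → n ≥ 1 → (A : Matrix n) → Nonsingular A →
    Σ (Fin n) (λ i → Σ (Fin n) (λ j →
      (A i j ≡ 𝟙) × ((k : Fin n) → ¬ (k ≡ j) → A i k ≡ 𝟘)))
corollary3p4 (ℕ.suc n) _ A nonsingular
  with π , π-one , π-trans , unique ← nonsingular⇒unique-transversal A nonsingular
  with j , isolated ← unique-transversal⇒isolated-row (λ i k → ¬? (A i k ≟𝕊 𝟘)) π π-trans unique =
  π j , j , π-one j , λ k k≢j → decidable-stable (A (π j) k ≟𝕊 𝟘) (isolated k k≢j)
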